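{- Let $q$ be an odd integer, $n=q^2+q+1$, and suppose $D\subseteq\mathbb{Z}_n$ is a difference set of size $q+1$ (so that a cyclic projective plane $\Pi_q$ exists). Let $J\subseteq\{1,\dots,\lfloor n/2\rfloor\}$ and let $1\le t\le q$. Suppose that the edges of the complete graph on vertex set $D$ whose lengths belong to $J$ form the union of $t$ pairwise edge-disjoint perfect matchings of this complete graph. Then \[tn\leq \alpha_1(C_n(J)).\]
   Context: A subset $D=\{d_0,\dots,d_q\}\subseteq\mathbb{Z}_n$ is a difference set if every nonzero $g\in\mathbb{Z}_n$ can be written uniquely as $g=d_i-d_j$ with $d_i\ne d_j$ in $D$; its translates $D+i$ ($i\in\mathbb{Z}_n$) are the lines of the cyclic projective plane on $\mathbb{Z}_n$. The length of a pair $\{x,y\}$ of distinct elements of $\mathbb{Z}_n$ is the unique $s\in\{1,\dots,\lfloor n/2\rfloor\}$ with $x-y\equiv\pm s\pmod n$. The circulant graph $C_n(J)$ has vertex set $\mathbb{Z}_n$, with $x,y$ adjacent iff the length of $\{x,y\}$ lies in $J$. A complete edge-coloring of a graph uses exactly $k$ colors such that for every pair of distinct colors there are two adjacent (sharing a vertex) edges receiving these colors; it is proper if adjacent edges receive distinct colors. The achromatic index $\alpha_1(G)$ is the largest $k$ such that $G$ has a proper complete edge-coloring with $k$ colors. -}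

module Defs where

open import Data.Nat using (ℕ; zero; suc; _+_; _*_; _∸_; _≤_; _<_; _⊔_; _⊓_; _≤ᵇ_)
open import Data.Nat.DivMod using (_/_)
open import Data.Bool using (if_then_else_)
open import Data.Fin using (Fin; toℕ)
open import Data.Fin.Subset using (Subset; _∈_; ∣_∣)
open import Data.List using (List)
open import Data.List.Membership.Propositional using () renaming (_∈_ to _∈ₗ_)
open import Data.Product using (Σ; ∃; ∃-syntax; _×_; _,_)
open import Relation.Binary.PropositionalEquality using (_≡_; _≢_)
open import Function.Bundles using (_⇔_)

diff : (n : ℕ) → Fin n → Fin n → ℕ
diff n x y = if toℕ y ≤ᵇ toℕ x then toℕ x ∸ toℕ y else (n + toℕ x) ∸ toℕ y

-- Length of the pair {x,y}: the s ∈ {1,…,⌊n/2⌋} with x - y ≡ ±s (mod n)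
-- (for x ≢ y).
len : (n : ℕ) → Fin n → Fin n → ℕ
len n x y = diff n x y ⊓ (n ∸ diff n x y)

IsDifferenceSet : (n : ℕ) → Subset n → Set
IsDifferenceSet n D =
  (g : Fin n) → toℕ g ≢ 0 →
    Σ (Fin n × Fin n) (λ { (x , y) →
      (x ∈ D × y ∈ D × x ≢ y × diff n x y ≡ toℕ g) ×
      ((x' y' : Fin n) → x' ∈ D → y' ∈ D → x' ≢ y' → diff n x' y' ≡ toℕ g →
         (x' ≡ x × y' ≡ y)) })

Adj : (n : ℕ) → List ℕ → Fin n → Fin n → Set
Adj n J x y = x ≢ y × len n x y ∈ₗ J

-- A proper complete edge-colouring of C_n(J) with exactly k colours.
-- c x y is the colour of the edge {x,y} (only meaningful when Adj n J x y);
-- it is required to be symmetric on edges.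
record ProperCompleteColouring (n : ℕ) (J : List ℕ) (k : ℕ) : Set where
  field
    colour    : Fin n → Fin n → Fin k
    symmetric : (x y : Fin n) → Adj n J x y → colour x y ≡ colour y x
    surjective : (i : Fin k) → ∃[ x ] ∃[ y ] (Adj n J x y × colour x y ≡ i)
    proper : (x y z : Fin n) → Adj n J x y → Adj n J x z → y ≢ z →
             colour x y ≢ colour x z
    complete : (i j : Fin k) → i ≢ j →
               ∃[ x ] ∃[ y ] ∃[ z ] (Adj n J x y × Adj n J x z ×
                                     colour x y ≡ i × colour x z ≡ j)

-- tn ≤ α₁(C_n(J)) where α₁ is the maximum number of colours of a proper
-- complete edge-colouring: equivalently some such colouring has ≥ m colours.
AchromaticIndexAtLeast : (n : ℕ) → List ℕ → ℕ → Set
AchromaticIndexAtLeast n J m = ∃[ k ] (m ≤ k × ProperCompleteColouring n J k)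

IsPerfectMatchingOn : (n : ℕ) → Subset n → (Fin n → Fin n) → Set
IsPerfectMatchingOn n D m =
  (x : Fin n) → x ∈ D → (m x ∈ D × m x ≢ x × m (m x) ≡ x)

IsMatchingDecomposition : (n : ℕ) → Subset n → List ℕ → (t : ℕ) →
                          (Fin t → Fin n → Fin n) → Set
IsMatchingDecomposition n D J t M =
  ((i : Fin t) → IsPerfectMatchingOn n D (M i)) ×
  ((i j : Fin t) → i ≢ j → (x : Fin n) → x ∈ D → M i x ≢ M j x) ×
  ((x y : Fin n) → x ∈ D → y ∈ D → x ≢ y →
     (len n x y ∈ₗ J ⇔ (∃[ i ] (M i x ≡ y))))

-- Every edge {x, y} of C_n(J) lies on exactly one line D ⊕ i, since D is a
-- difference set, and as lengths are translation invariant it is an edge of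
-- exactly one translated matching M j ⊕ i; colour it (j , i).  This gives t·n
-- colours, each colour class is a matching, so the colouring is proper, and the
-- classes (j , i), (j′ , i′) meet at a common point of the lines D ⊕ i and
-- D ⊕ i′, which exists because two lines of the plane always meet.
module Submission where

open import Defs
open import Data.Nat using (ℕ; suc; _+_; _*_; _∸_; _≤_; _<_; _%_; _⊓_; _≤ᵇ_; NonZero; ≢-nonZero)
open import Data.Nat.Properties
open import Data.Nat.DivMod using (_/_; m%n<n; %-distribˡ-+; m%n%n≡m%n; [m+n]%n≡m%n; m<n⇒m%n≡m)
open import Data.Bool using (true; false; T)
open import Data.Unit using (tt)
open import Data.Fin using (Fin; zero; toℕ; fromℕ<; combine; remQuot)
open import Data.Fin.Properties using (toℕ<n; toℕ-fromℕ<; toℕ-injective; any?; combine-remQuot; combine-injectiveˡ; combine-injectiveʳ) renaming (_≟_ to _≟ᶠ_)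
open import Data.Fin.Subset using (Subset; _∈_; ∣_∣; Nonempty)
open import Data.Fin.Subset.Properties using (nonempty?; Empty-unique; ∣⊥∣≡0)
open import Data.List using (List)
open import Data.List.Membership.Propositional using () renaming (_∈_ to _∈ₗ_)
open import Data.List.Relation.Unary.All using (All)
open import Data.Product using (Σ; ∃-syntax; _×_; _,_; proj₁; proj₂)
open import Function.Base using (_∘_)
open import Function.Bundles using (Equivalence)
open import Relation.Nullary using (yes; no; contradiction)
open import Relation.Binary.PropositionalEquality

combine-surjective : ∀ {m n} (c : Fin (m * n)) → ∃[ j ] ∃[ i ] combine {m} {n} j i ≡ c
combine-surjective {m} {n} c = proj₁ (remQuot {m} n c) , proj₂ (remQuot {m} n c) , combine-remQuot {m} n c

∣p∣≡1+k⇒Nonempty : ∀ {m k} (p : Subset m) → ∣ p ∣ ≡ suc k → Nonempty p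
∣p∣≡1+k⇒Nonempty {m} p ∣p∣≡1+k with nonempty? p
... | yes p≠∅ = p≠∅
... | no p=∅  = contradiction (trans (sym ∣p∣≡1+k) (trans (cong ∣_∣ (Empty-unique p=∅)) (∣⊥∣≡0 m))) λ ()

module Cyclic (n : ℕ) .{{_ : NonZero n}} where

  open ≡-Reasoning

  [m%n+k]%n≡[m+k]%n : ∀ m k → (m % n + k) % n ≡ (m + k) % n
  [m%n+k]%n≡[m+k]%n m k = begin
    (m % n + k) % n           ≡⟨ %-distribˡ-+ (m % n) k n ⟩
    (m % n % n + k % n) % n   ≡⟨ cong (λ u → (u + k % n) % n) (m%n%n≡m%n m n) ⟩
    (m % n + k % n) % n       ≡⟨ %-distribˡ-+ m k n ⟨
    (m + k) % n               ∎

  [m+k%n]%n≡[m+k]%n : ∀ m k → (m + k % n) % n ≡ (m + k) % n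
  [m+k%n]%n≡[m+k]%n m k = begin
    (m + k % n) % n   ≡⟨ cong (_% n) (+-comm m (k % n)) ⟩
    (k % n + m) % n   ≡⟨ [m%n+k]%n≡[m+k]%n k m ⟩
    (k + m) % n       ≡⟨ cong (_% n) (+-comm k m) ⟩
    (m + k) % n       ∎

  [[a+b]%n+[n∸a]]%n≡b : ∀ {a b} → a ≤ n → b < n → ((a + b) % n + (n ∸ a)) % n ≡ b
  [[a+b]%n+[n∸a]]%n≡b {a} {b} a≤n b<n = begin
    ((a + b) % n + (n ∸ a)) % n   ≡⟨ [m%n+k]%n≡[m+k]%n (a + b) (n ∸ a) ⟩
    (a + b + (n ∸ a)) % n         ≡⟨ cong (λ u → (u + (n ∸ a)) % n) (+-comm a b) ⟩
    (b + a + (n ∸ a)) % n         ≡⟨ cong (_% n) (+-assoc b a (n ∸ a)) ⟩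
    (b + (a + (n ∸ a))) % n       ≡⟨ cong (λ u → (b + u) % n) (m+[n∸m]≡n a≤n) ⟩
    (b + n) % n                   ≡⟨ [m+n]%n≡m%n b n ⟩
    b % n                         ≡⟨ m<n⇒m%n≡m b<n ⟩
    b                             ∎

  diff<n : ∀ x y → diff n x y < n
  diff<n x y with toℕ y ≤ᵇ toℕ x in eq
  ... | true  = ≤-<-trans (m∸n≤m (toℕ x) (toℕ y)) (toℕ<n x)
  ... | false =
    <-≤-trans (∸-monoˡ-< (+-monoʳ-< n x<y) y≤n+x) (≤-reflexive (m+n∸n≡m n (toℕ y)))
    where
      x<y : toℕ x < toℕ y
      x<y = ≰⇒> (λ y≤x → subst T eq (≤⇒≤ᵇ y≤x))
      y≤n+x : toℕ y ≤ n + toℕ x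
      y≤n+x = ≤-trans (<⇒≤ (toℕ<n y)) (m≤m+n n (toℕ x))

  [y+diff]%n≡x : ∀ x y → (toℕ y + diff n x y) % n ≡ toℕ x
  [y+diff]%n≡x x y with toℕ y ≤ᵇ toℕ x in eq
  ... | true  rewrite m+[n∸m]≡n (≤ᵇ⇒≤ (toℕ y) (toℕ x) (subst T (sym eq) tt)) =
    m<n⇒m%n≡m (toℕ<n x)
  ... | false rewrite m+[n∸m]≡n (≤-trans (<⇒≤ (toℕ<n y)) (m≤m+n n (toℕ x))) | +-comm n (toℕ x) =
    trans ([m+n]%n≡m%n (toℕ x) n) (m<n⇒m%n≡m (toℕ<n x))

  infixl 6 _⊕_ _⊖_

  _⊕_ : Fin n → Fin n → Fin n
  x ⊕ y = fromℕ< (m%n<n (toℕ x + toℕ y) n)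

  _⊖_ : Fin n → Fin n → Fin n
  x ⊖ y = fromℕ< (diff<n x y)

  toℕ-⊕ : ∀ x y → toℕ (x ⊕ y) ≡ (toℕ x + toℕ y) % n
  toℕ-⊕ x y = toℕ-fromℕ< (m%n<n (toℕ x + toℕ y) n)

  toℕ-⊖ : ∀ x y → toℕ (x ⊖ y) ≡ diff n x y
  toℕ-⊖ x y = toℕ-fromℕ< (diff<n x y)

  ⊕-comm : ∀ x y → x ⊕ y ≡ y ⊕ x
  ⊕-comm x y = toℕ-injective (begin
    toℕ (x ⊕ y)               ≡⟨ toℕ-⊕ x y ⟩
    (toℕ x + toℕ y) % n       ≡⟨ cong (_% n) (+-comm (toℕ x) (toℕ y)) ⟩
    (toℕ y + toℕ x) % n       ≡⟨ toℕ-⊕ y x ⟨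
    toℕ (y ⊕ x)               ∎)

  ⊕-assoc : ∀ x y z → x ⊕ y ⊕ z ≡ x ⊕ (y ⊕ z)
  ⊕-assoc x y z = toℕ-injective (begin
    toℕ (x ⊕ y ⊕ z)                         ≡⟨ toℕ-⊕ (x ⊕ y) z ⟩
    (toℕ (x ⊕ y) + toℕ z) % n               ≡⟨ cong (λ u → (u + toℕ z) % n) (toℕ-⊕ x y) ⟩
    ((toℕ x + toℕ y) % n + toℕ z) % n       ≡⟨ [m%n+k]%n≡[m+k]%n (toℕ x + toℕ y) (toℕ z) ⟩
    (toℕ x + toℕ y + toℕ z) % n             ≡⟨ cong (_% n) (+-assoc (toℕ x) (toℕ y) (toℕ z)) ⟩
    (toℕ x + (toℕ y + toℕ z)) % n           ≡⟨ [m+k%n]%n≡[m+k]%n (toℕ x) (toℕ y + toℕ z) ⟨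
    (toℕ x + (toℕ y + toℕ z) % n) % n       ≡⟨ cong (λ u → (toℕ x + u) % n) (toℕ-⊕ y z) ⟨
    (toℕ x + toℕ (y ⊕ z)) % n               ≡⟨ toℕ-⊕ x (y ⊕ z) ⟨
    toℕ (x ⊕ (y ⊕ z))                       ∎)

  ⊕-cancelˡ : ∀ x {y z} → x ⊕ y ≡ x ⊕ z → y ≡ z
  ⊕-cancelˡ x {y} {z} eq = toℕ-injective (begin
    toℕ y                                          ≡⟨ [[a+b]%n+[n∸a]]%n≡b x≤n (toℕ<n y) ⟨
    ((toℕ x + toℕ y) % n + (n ∸ toℕ x)) % n        ≡⟨ cong (λ u → (u + (n ∸ toℕ x)) % n) sums ⟩
    ((toℕ x + toℕ z) % n + (n ∸ toℕ x)) % n        ≡⟨ [[a+b]%n+[n∸a]]%n≡b x≤n (toℕ<n z) ⟩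
    toℕ z                                          ∎)
    where
      x≤n = <⇒≤ (toℕ<n x)
      sums = trans (sym (toℕ-⊕ x y)) (trans (cong toℕ eq) (toℕ-⊕ x z))

  ⊕-cancelʳ : ∀ {x y} z → x ⊕ z ≡ y ⊕ z → x ≡ y
  ⊕-cancelʳ {x} {y} z eq = ⊕-cancelˡ z (trans (⊕-comm z x) (trans eq (⊕-comm y z)))

  x⊕[y⊖x]≡y : ∀ x y → x ⊕ (y ⊖ x) ≡ y
  x⊕[y⊖x]≡y x y = toℕ-injective (begin
    toℕ (x ⊕ (y ⊖ x))               ≡⟨ toℕ-⊕ x (y ⊖ x) ⟩
    (toℕ x + toℕ (y ⊖ x)) % n       ≡⟨ cong (λ u → (toℕ x + u) % n) (toℕ-⊖ y x) ⟩
    (toℕ x + diff n y x) % n        ≡⟨ [y+diff]%n≡x y x ⟩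
    toℕ y                           ∎)

  x⊕r≡y⇒r≡y⊖x : ∀ {x y r} → x ⊕ r ≡ y → r ≡ y ⊖ x
  x⊕r≡y⇒r≡y⊖x {x} {y} eq = ⊕-cancelˡ x (trans eq (sym (x⊕[y⊖x]≡y x y)))

  [x⊕i]⊖x≡i : ∀ x i → x ⊕ i ⊖ x ≡ i
  [x⊕i]⊖x≡i x i = sym (x⊕r≡y⇒r≡y⊖x {x} refl)

  [x⊕y]⊕z≡[x⊕z]⊕y : ∀ x y z → x ⊕ y ⊕ z ≡ x ⊕ z ⊕ y
  [x⊕y]⊕z≡[x⊕z]⊕y x y z = begin
    x ⊕ y ⊕ z       ≡⟨ ⊕-assoc x y z ⟩
    x ⊕ (y ⊕ z)     ≡⟨ cong (x ⊕_) (⊕-comm y z) ⟩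
    x ⊕ (z ⊕ y)     ≡⟨ ⊕-assoc x z y ⟨
    x ⊕ z ⊕ y       ∎

  [x⊕i]⊖[y⊕i]≡x⊖y : ∀ x y i → (x ⊕ i) ⊖ (y ⊕ i) ≡ x ⊖ y
  [x⊕i]⊖[y⊕i]≡x⊖y x y i = sym (x⊕r≡y⇒r≡y⊖x (begin
    y ⊕ i ⊕ (x ⊖ y)     ≡⟨ [x⊕y]⊕z≡[x⊕z]⊕y y i (x ⊖ y) ⟩
    y ⊕ (x ⊖ y) ⊕ i     ≡⟨ cong (_⊕ i) (x⊕[y⊖x]≡y y x) ⟩
    x ⊕ i               ∎))

  ⊖-cancelˡ : ∀ x {y z} → x ⊖ y ≡ x ⊖ z → y ≡ z
  ⊖-cancelˡ x {y} {z} eq = ⊕-cancelʳ (x ⊖ y) (begin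
    y ⊕ (x ⊖ y)     ≡⟨ x⊕[y⊖x]≡y y x ⟩
    x               ≡⟨ x⊕[y⊖x]≡y z x ⟨
    z ⊕ (x ⊖ z)     ≡⟨ cong (z ⊕_) eq ⟨
    z ⊕ (x ⊖ y)     ∎)

  toℕ[x⊖y]≡0⇒x≡y : ∀ x y → toℕ (x ⊖ y) ≡ 0 → x ≡ y
  toℕ[x⊖y]≡0⇒x≡y x y eq = toℕ-injective (begin
    toℕ x                         ≡⟨ cong toℕ (x⊕[y⊖x]≡y y x) ⟨
    toℕ (y ⊕ (x ⊖ y))             ≡⟨ toℕ-⊕ y (x ⊖ y) ⟩
    (toℕ y + toℕ (x ⊖ y)) % n     ≡⟨ cong (λ u → (toℕ y + u) % n) eq ⟩
    (toℕ y + 0) % n               ≡⟨ cong (_% n) (+-identityʳ (toℕ y)) ⟩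
    toℕ y % n                     ≡⟨ m<n⇒m%n≡m (toℕ<n y) ⟩
    toℕ y                         ∎)

  toℕ[x⊖y]≢0 : ∀ {x y} → x ≢ y → toℕ (x ⊖ y) ≢ 0
  toℕ[x⊖y]≢0 {x} {y} x≢y = x≢y ∘ toℕ[x⊖y]≡0⇒x≡y x y

  len-⊕ : ∀ x y i → len n (x ⊕ i) (y ⊕ i) ≡ len n x y
  len-⊕ x y i = cong (λ d → d ⊓ (n ∸ d)) (begin
    diff n (x ⊕ i) (y ⊕ i)        ≡⟨ toℕ-⊖ (x ⊕ i) (y ⊕ i) ⟨
    toℕ ((x ⊕ i) ⊖ (y ⊕ i))       ≡⟨ cong toℕ ([x⊕i]⊖[y⊕i]≡x⊖y x y i) ⟩
    toℕ (x ⊖ y)                   ≡⟨ toℕ-⊖ x y ⟩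
    diff n x y                    ∎)

  x⊖y≡j⊖i⇒x⊕i≡y⊕j : ∀ {x y i j} → x ⊖ y ≡ j ⊖ i → x ⊕ i ≡ y ⊕ j
  x⊖y≡j⊖i⇒x⊕i≡y⊕j {x} {y} {i} {j} eq = begin
    x ⊕ i                 ≡⟨ cong (_⊕ i) (x⊕[y⊖x]≡y y x) ⟨
    y ⊕ (x ⊖ y) ⊕ i       ≡⟨ [x⊕y]⊕z≡[x⊕z]⊕y y (x ⊖ y) i ⟩
    y ⊕ i ⊕ (x ⊖ y)       ≡⟨ ⊕-assoc y i (x ⊖ y) ⟩
    y ⊕ (i ⊕ (x ⊖ y))     ≡⟨ cong (λ r → y ⊕ (i ⊕ r)) eq ⟩
    y ⊕ (i ⊕ (j ⊖ i))     ≡⟨ cong (y ⊕_) (x⊕[y⊖x]≡y i j) ⟩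
    y ⊕ j                 ∎

module DifferenceSet (n : ℕ) .{{_ : NonZero n}} {D : Subset n} (ds : IsDifferenceSet n D) where

  open Cyclic n

  Represents : Fin n → Fin n × Fin n → Set
  Represents g (a , b) = a ∈ D × b ∈ D × a ≢ b × a ⊖ b ≡ g

  representation : ∀ g → toℕ g ≢ 0 → Σ (Fin n × Fin n) (Represents g)
  representation g g≢0 with ds g g≢0
  ... | (a , b) , (a∈D , b∈D , a≢b , diff≡g) , _ =
    (a , b) , a∈D , b∈D , a≢b , toℕ-injective (trans (toℕ-⊖ a b) diff≡g)

  representation-unique : ∀ g (g≢0 : toℕ g ≢ 0) {a b} → Represents g (a , b) →
                          proj₁ (representation g g≢0) ≡ (a , b)
  representation-unique g g≢0 {a} {b} (a∈D , b∈D , a≢b , a⊖b≡g) with ds g g≢0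
  ... | _ , _ , unique with unique a b a∈D b∈D a≢b (trans (sym (toℕ-⊖ a b)) (cong toℕ a⊖b≡g))
  ... | refl , refl = refl

  -- Distinct x, y lie on the line D ⊕ shift as a ⊕ shift and b ⊕ shift, where (a , b) = base.
  base : ∀ {x y} → x ≢ y → Fin n × Fin n
  base {x} {y} x≢y = proj₁ (representation (x ⊖ y) (toℕ[x⊖y]≢0 x≢y))

  shift : ∀ {x y} → x ≢ y → Fin n
  shift {x} x≢y = x ⊖ proj₁ (base x≢y)

  base-represents : ∀ {x y} (x≢y : x ≢ y) → Represents (x ⊖ y) (base x≢y)
  base-represents {x} {y} x≢y = proj₂ (representation (x ⊖ y) (toℕ[x⊖y]≢0 x≢y))

  base⊕shift≡x : ∀ {x y} (x≢y : x ≢ y) → proj₁ (base x≢y) ⊕ shift x≢y ≡ x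
  base⊕shift≡x {x} x≢y = x⊕[y⊖x]≡y (proj₁ (base x≢y)) x

  base⊕shift≡y : ∀ {x y} (x≢y : x ≢ y) → proj₂ (base x≢y) ⊕ shift x≢y ≡ y
  base⊕shift≡y {x} {y} x≢y = ⊖-cancelˡ x (begin
    x ⊖ (b ⊕ i)             ≡⟨ cong (_⊖ (b ⊕ i)) (base⊕shift≡x x≢y) ⟨
    (a ⊕ i) ⊖ (b ⊕ i)       ≡⟨ [x⊕i]⊖[y⊕i]≡x⊖y a b i ⟩
    a ⊖ b                   ≡⟨ proj₂ (proj₂ (proj₂ (base-represents x≢y))) ⟩
    x ⊖ y                   ∎)
    where
      open ≡-Reasoning
      a = proj₁ (base x≢y)
      b = proj₂ (base x≢y)
      i = shift x≢y

  base-⊕ : ∀ {a b i} → a ∈ D → b ∈ D → a ≢ b → (p : a ⊕ i ≢ b ⊕ i) → base p ≡ (a , b)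
  base-⊕ {a} {b} {i} a∈D b∈D a≢b p =
    representation-unique _ (toℕ[x⊖y]≢0 p) (a∈D , b∈D , a≢b , sym ([x⊕i]⊖[y⊕i]≡x⊖y a b i))

  lines-meet : Nonempty D → ∀ i j → ∃[ a ] ∃[ b ] (a ∈ D × b ∈ D × a ⊕ i ≡ b ⊕ j)
  lines-meet (c , c∈D) i j with i ≟ᶠ j
  ... | yes refl = c , c , c∈D , c∈D , refl
  ... | no i≢j with representation (j ⊖ i) (toℕ[x⊖y]≢0 (i≢j ∘ sym))
  ...   | (a , b) , a∈D , b∈D , _ , a⊖b≡j⊖i = a , b , a∈D , b∈D , x⊖y≡j⊖i⇒x⊕i≡y⊕j {a} {b} a⊖b≡j⊖i

module Colouring (n : ℕ) .{{_ : NonZero n}} {D : Subset n} (ds : IsDifferenceSet n D)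
  {J : List ℕ} {t : ℕ} {M : Fin t → Fin n → Fin n} (dec : IsMatchingDecomposition n D J t M)
  (j₀ : Fin t) where

  open Cyclic n
  open DifferenceSet n ds

  private
    matching : ∀ j → IsPerfectMatchingOn n D (M j)
    matching = proj₁ dec

    disjoint : ∀ j k → j ≢ k → ∀ x → x ∈ D → M j x ≢ M k x
    disjoint = proj₁ (proj₂ dec)

    length∈J⇔matched : ∀ x y → x ∈ D → y ∈ D → x ≢ y → Equivalence _ _
    length∈J⇔matched = proj₂ (proj₂ dec)

  M∈D : ∀ j {a} → a ∈ D → M j a ∈ D
  M∈D j a∈D = proj₁ (matching j _ a∈D)

  a≢Mja : ∀ j {a} → a ∈ D → a ≢ M j a
  a≢Mja j a∈D = proj₁ (proj₂ (matching j _ a∈D)) ∘ sym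

  M-involutive : ∀ j {a} → a ∈ D → M j (M j a) ≡ a
  M-involutive j a∈D = proj₂ (proj₂ (matching j _ a∈D))

  -- j₀ is a junk value for pairs of D not matched by any M j.
  matchIndex : Fin n → Fin n → Fin t
  matchIndex a b with any? (λ j → M j a ≟ᶠ b)
  ... | yes (j , _) = j
  ... | no _        = j₀

  matchIndex-M : ∀ j {a} → a ∈ D → matchIndex a (M j a) ≡ j
  matchIndex-M j {a} a∈D with any? (λ k → M k a ≟ᶠ M j a)
  ... | no ¬match = contradiction (j , refl) ¬match
  ... | yes (k , Mka≡Mja) with k ≟ᶠ j
  ...   | yes k≡j = k≡j
  ...   | no k≢j  = contradiction Mka≡Mja (disjoint k j k≢j a a∈D)

  -- Loops are not edges; their colour is junk.
  colour : Fin n → Fin n → Fin (t * n)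
  colour x y with x ≟ᶠ y
  ... | yes _   = combine j₀ x
  ... | no x≢y = combine (matchIndex (proj₁ (base x≢y)) (proj₂ (base x≢y))) (shift x≢y)

  edge-⊕ : ∀ i j {a} → a ∈ D → Adj n J (a ⊕ i) (M j a ⊕ i)
  edge-⊕ i j {a} a∈D =
    a≢Mja j a∈D ∘ ⊕-cancelʳ i ,
    subst (_∈ₗ J) (sym (len-⊕ a (M j a) i))
      (Equivalence.from (length∈J⇔matched a (M j a) a∈D (M∈D j a∈D) (a≢Mja j a∈D)) (j , refl))

  colour-⊕ : ∀ i j {a} → a ∈ D → colour (a ⊕ i) (M j a ⊕ i) ≡ combine j i
  colour-⊕ i j {a} a∈D with a ⊕ i ≟ᶠ M j a ⊕ i
  ... | yes eq = contradiction (⊕-cancelʳ i eq) (a≢Mja j a∈D)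
  ... | no p rewrite base-⊕ a∈D (M∈D j a∈D) (a≢Mja j a∈D) p =
    cong₂ combine (matchIndex-M j a∈D) ([x⊕i]⊖x≡i a i)

  data EdgeView (x : Fin n) : Fin n → Set where
    translate : ∀ i j {a} → a ∈ D → x ≡ a ⊕ i → EdgeView x (M j a ⊕ i)

  edgeView : ∀ {x y} → Adj n J x y → EdgeView x y
  edgeView {x} {y} (x≢y , len∈J) = subst (EdgeView x) y≡ (translate i j a∈D (sym (base⊕shift≡x x≢y)))
    where
      a = proj₁ (base x≢y)
      b = proj₂ (base x≢y)
      i = shift x≢y
      a∈D = proj₁ (base-represents x≢y)
      b∈D = proj₁ (proj₂ (base-represents x≢y))
      a≢b = proj₁ (proj₂ (proj₂ (base-represents x≢y)))
      len-xy≡len-ab : len n x y ≡ len n a b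
      len-xy≡len-ab = trans (sym (cong₂ (len n) (base⊕shift≡x x≢y) (base⊕shift≡y x≢y))) (len-⊕ a b i)
      len-ab∈J : len n a b ∈ₗ J
      len-ab∈J = subst (_∈ₗ J) len-xy≡len-ab len∈J
      matched = Equivalence.to (length∈J⇔matched a b a∈D b∈D a≢b) len-ab∈J
      j = proj₁ matched
      y≡ : M j a ⊕ i ≡ y
      y≡ = trans (cong (_⊕ i) (proj₂ matched)) (base⊕shift≡y x≢y)

  colour-symmetric : ∀ x y → Adj n J x y → colour x y ≡ colour y x
  colour-symmetric x y adj = symmetric (edgeView adj)
    where
      open ≡-Reasoning
      symmetric : ∀ {x y} → EdgeView x y → colour x y ≡ colour y x
      symmetric (translate i j {a} a∈D refl) = begin
        colour (a ⊕ i) (M j a ⊕ i)              ≡⟨ colour-⊕ i j a∈D ⟩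
        combine j i                             ≡⟨ colour-⊕ i j (M∈D j a∈D) ⟨
        colour (M j a ⊕ i) (M j (M j a) ⊕ i)    ≡⟨ cong (λ b → colour (M j a ⊕ i) (b ⊕ i)) (M-involutive j a∈D) ⟩
        colour (M j a ⊕ i) (a ⊕ i)              ∎

  colour-proper : ∀ x y z → Adj n J x y → Adj n J x z → y ≢ z → colour x y ≢ colour x z
  colour-proper x y z adj-xy adj-xz = proper (edgeView adj-xy) (edgeView adj-xz)
    where
      open ≡-Reasoning
      proper : ∀ {x y z} → EdgeView x y → EdgeView x z → y ≢ z → colour x y ≢ colour x z
      proper (translate i j {a} a∈D refl) (translate i′ j′ {a′} a′∈D x≡a′⊕i′) y≢z same = y≢z (begin
        M j a ⊕ i       ≡⟨ cong₂ (λ k b → M k b ⊕ i) j≡j′ a≡a′ ⟩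
        M j′ a′ ⊕ i     ≡⟨ cong (M j′ a′ ⊕_) i≡i′ ⟩
        M j′ a′ ⊕ i′    ∎)
        where
          colours : combine j i ≡ combine j′ i′
          colours = begin
            combine j i                           ≡⟨ colour-⊕ i j a∈D ⟨
            colour (a ⊕ i) (M j a ⊕ i)            ≡⟨ same ⟩
            colour (a ⊕ i) (M j′ a′ ⊕ i′)         ≡⟨ cong (λ w → colour w (M j′ a′ ⊕ i′)) x≡a′⊕i′ ⟩
            colour (a′ ⊕ i′) (M j′ a′ ⊕ i′)       ≡⟨ colour-⊕ i′ j′ a′∈D ⟩
            combine j′ i′                         ∎
          j≡j′ = combine-injectiveˡ j i j′ i′ colours
          i≡i′ = combine-injectiveʳ j i j′ i′ colours
          a≡a′ = ⊕-cancelʳ i (trans x≡a′⊕i′ (cong (a′ ⊕_) (sym i≡i′)))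

  colour-surjective : Nonempty D → ∀ c → ∃[ x ] ∃[ y ] (Adj n J x y × colour x y ≡ c)
  colour-surjective (a , a∈D) c with combine-surjective c
  ... | j , i , combine≡c = a ⊕ i , M j a ⊕ i , edge-⊕ i j a∈D , trans (colour-⊕ i j a∈D) combine≡c

  colour-complete : Nonempty D → ∀ c c′ → c ≢ c′ →
    ∃[ x ] ∃[ y ] ∃[ z ] (Adj n J x y × Adj n J x z × colour x y ≡ c × colour x z ≡ c′)
  colour-complete D≠∅ c c′ _
    with combine-surjective c | combine-surjective c′
  ... | j , i , combine≡c | j′ , i′ , combine≡c′ with lines-meet D≠∅ i i′
  ... | a , a′ , a∈D , a′∈D , a⊕i≡a′⊕i′ =
    a ⊕ i , M j a ⊕ i , M j′ a′ ⊕ i′ ,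
    edge-⊕ i j a∈D , subst (λ x → Adj n J x (M j′ a′ ⊕ i′)) (sym a⊕i≡a′⊕i′) (edge-⊕ i′ j′ a′∈D) ,
    trans (colour-⊕ i j a∈D) combine≡c ,
    trans (cong (λ x → colour x (M j′ a′ ⊕ i′)) a⊕i≡a′⊕i′) (trans (colour-⊕ i′ j′ a′∈D) combine≡c′)

  properCompleteColouring : Nonempty D → ProperCompleteColouring n J (t * n)
  properCompleteColouring D≠∅ = record
    { colour     = colour
    ; symmetric  = colour-symmetric
    ; surjective = colour-surjective D≠∅
    ; proper     = colour-proper
    ; complete   = colour-complete D≠∅
    }

theorem9 : (q n : ℕ) → q % 2 ≡ 1 → n ≡ q * q + q + 1 →
    (D : Subset n) → IsDifferenceSet n D → ∣ D ∣ ≡ suc q →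
    (J : List ℕ) → All (λ s → 1 ≤ s × s ≤ n / 2) J →
    (t : ℕ) → 1 ≤ t → t ≤ q →
    (M : Fin t → Fin n → Fin n) → IsMatchingDecomposition n D J t M →
    AchromaticIndexAtLeast n J (t * n)
-- q odd, the bounds on J and t ≤ q only matter for the matchings M to exist.
theorem9 q n _ n≡q²+q+1 D ds ∣D∣≡1+q J _ t@(suc _) _ _ M dec =
  t * n , ≤-refl , Colouring.properCompleteColouring n {{nonZero-n}} ds dec zero D≠∅
  where
    D≠∅ : Nonempty D
    D≠∅ = ∣p∣≡1+k⇒Nonempty D ∣D∣≡1+q

    nonZero-n : NonZero n
    nonZero-n = ≢-nonZero λ n≡0 → contradiction (trans (sym n≡0) (trans n≡q²+q+1 (+-comm (q * q + q) 1))) λ ()
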